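{- Let $q$ be a prime power, $\mathrm{PG}(n,q)=\mathrm{AG}(n,q)\cup H_\infty$, $U\subset\mathrm{AG}(n,q)$ with $|U|=q^{n-1}$, and let $k\le n-2$. If a $k$-dimensional subspace $S_k\subset H_\infty$ is determined by $U$, then there exists an $(n-2)$-dimensional subspace of $H_\infty$ containing $S_k$ which is determined by $U$.
   Context: For $U\subset\mathrm{AG}(n,q)$ and an integer $k\le n-2$, a $k$-dimensional subspace $S_k$ of the hyperplane at infinity $H_\infty$ is determined by $U$ if there is an affine $(k+1)$-dimensional subspace $T_{k+1}$ whose hyperplane at infinity is $S_k$ and which contains $k+2$ affinely independent points of $U$. -}

module Defs where

open import Level using (0ℓ)
open import Data.Nat using (ℕ; zero; suc; _+_)
open import Data.Fin using (Fin; zero; suc)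
open import Data.Vec using (Vec; zipWith; map; replicate)
open import Data.Product using (Σ; ∃; _×_; _,_)
open import Relation.Binary.PropositionalEquality using (_≡_; _≢_)
open import Algebra.Structures using (IsCommutativeRing)
open import Function.Bundles using (_↔_)
open import Function.Definitions using (Injective)

-- A finite field with q elements (q is then automatically a prime power).
record FiniteField : Set₁ where
  infixl 6 _+F_
  infixl 7 _*F_
  field
    F     : Set
    _+F_  : F → F → F
    _*F_  : F → F → F
    -F_   : F → F
    0F    : F
    1F    : F
    isCommutativeRing : IsCommutativeRing _≡_ _+F_ _*F_ -F_ 0F 1F
    0≢1   : 0F ≢ 1F
    inverse : ∀ x → x ≢ 0F → ∃ λ y → x *F y ≡ 1F
    q     : ℕ
    enum  : Fin q ↔ F

module Geometry (𝔽 : FiniteField) where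
  open FiniteField 𝔽

  -- Points of AG(n,q) and vectors of F^n (directions; the points of
  -- the hyperplane at infinity H∞ are the 1-dim subspaces of F^n).
  Pt : ℕ → Set
  Pt n = Vec F n

  _⊕_ : ∀ {n} → Pt n → Pt n → Pt n
  _⊕_ = zipWith _+F_

  _⊖_ : ∀ {n} → Pt n → Pt n → Pt n
  x ⊖ y = zipWith (λ a b → a +F (-F b)) x y

  _·_ : ∀ {n} → F → Pt n → Pt n
  c · v = map (c *F_) v

  𝟎 : ∀ {n} → Pt n
  𝟎 = replicate _ 0F

  lincomb : ∀ {n} m → (Fin m → F) → (Fin m → Pt n) → Pt n
  lincomb zero    c v = 𝟎
  lincomb (suc m) c v = (c zero · v zero) ⊕ lincomb m (λ i → c (suc i)) (λ i → v (suc i))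

  Span : ∀ {n m} → (Fin m → Pt n) → Pt n → Set
  Span {m = m} v x = ∃ λ (c : Fin m → F) → lincomb m c v ≡ x

  LinIndep : ∀ {n m} → (Fin m → Pt n) → Set
  LinIndep {m = m} v = ∀ (c : Fin m → F) → lincomb m c v ≡ 𝟎 → ∀ i → c i ≡ 0F

  -- A k-dimensional (projective) subspace of H∞ ⊂ PG(n,q) is given by a
  -- basis of the corresponding (k+1)-dimensional linear subspace of F^n.
  record SubspaceAtInfinity (n k : ℕ) : Set where
    constructor subspace
    field
      basis : Fin (suc k) → Pt n
      indep : LinIndep basis

  ⟦_⟧ : ∀ {n k} → SubspaceAtInfinity n k → Pt n → Set
  ⟦ subspace b _ ⟧ = Span b

  _⊆∞_ : ∀ {n k l} → SubspaceAtInfinity n k → SubspaceAtInfinity n l → Set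
  S ⊆∞ S' = ∀ x → ⟦ S ⟧ x → ⟦ S' ⟧ x

  -- points in the affine subspace p + ⟦S⟧ (the affine (k+1)-space through p
  -- whose hyperplane at infinity is S)
  InAffine : ∀ {n k} → Pt n → SubspaceAtInfinity n k → Pt n → Set
  InAffine p S x = ⟦ S ⟧ (x ⊖ p)

  AffIndep : ∀ {n m} → (Fin (suc m) → Pt n) → Set
  AffIndep x = LinIndep (λ i → x (suc i) ⊖ x zero)

  -- U ⊆ AG(n,q) with |U| = N, given by an injective enumeration
  record PointSet (n N : ℕ) : Set where
    field
      elem : Fin N → Pt n
      elem-inj : Injective _≡_ _≡_ elem

  _∈U_ : ∀ {n N} → Pt n → PointSet n N → Set
  x ∈U U = ∃ λ i → PointSet.elem U i ≡ x

  -- S_k ⊂ H∞ is determined by U: there is an affine (k+1)-space T (through p)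
  -- with T ∩ H∞ = S_k, containing k+2 affinely independent points of U.
  Determined : ∀ {n N k} → PointSet n N → SubspaceAtInfinity n k → Set
  Determined {n} {N} {k} U S =
    Σ (Pt n) λ p → Σ (Fin (suc (suc k)) → Pt n) λ x →
      (∀ i → x i ∈U U) × (∀ i → InAffine p S (x i)) × AffIndep x

module Submission where

open import Defs
open import Data.Nat using (ℕ; _+_; _∸_; _^_; _≤_)
open import Data.Product using (Σ; _×_)

-- Let S = S_k be determined by U, witnessed by a point p
-- and k+2 affinely independent points x₀,…,x_{k+1} of U in the affine space
-- p + S.  An affine (m+1)-space contains exactly q^(m+1) points, so as long as
-- q^(m+1) < |U| some u ∈ U lies outside p + S; adjoining the direction u − p
-- to S gives an (m+1)-dimensional subspace at infinity containing S, and
-- x₀, u, x₁, …, x_{k+1} are affinely independent points of U in p + ⟨S, u − p⟩,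
-- so the larger subspace is again determined by U.  Since |U| = q^(n-1) >
-- q^(n-2), this step can be repeated up to dimension n − 2.

open import Level using (0ℓ)
open import Data.Nat using (suc; s≤s; _<_; _≤′_; ≤′-refl; ≤′-step)
open import Data.Nat.Properties
  using (<-trans; <⇒≱; n<1+n; ^-monoʳ-<; ≤⇒≤′; m+n≤o⇒m≤o∸n; m+n≤o⇒n≤o)
open import Data.Fin using (Fin; zero; suc; funToFin; finToFun)
open import Data.Fin.Properties
  using (any?; injective⇒≤; finToFun-funToFin) renaming (_≟_ to _≟Fin_)
open import Data.Vec using ([]; _∷_)
open import Data.Vec.Properties
  using (zipWith-identityˡ; zipWith-identityʳ; ∷-injective; ≡-dec)
open import Data.Vec.Functional using () renaming (_∷_ to _◂_; tail to tailᶠ)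
open import Data.Product using (_,_; proj₁; proj₂)
open import Data.Empty using (⊥-elim)
open import Function using (_∘_)
open import Function.Bundles using (Inverse)
open import Function.Properties.Inverse using (↔-sym; ↔⇒↣)
open import Relation.Nullary using (¬_; Dec; yes; no)
open import Relation.Nullary.Decidable using (¬?; decidable-stable; via-injection)
open import Relation.Binary.PropositionalEquality
open import Algebra.Bundles using (CommutativeRing)
open import Algebra.Structures using (IsCommutativeRing)
import Algebra.Properties.Ring as RingProperties
import Algebra.Properties.AbelianGroup as AbelianGroupProperties
import Algebra.Properties.CommutativeSemigroup as CommutativeSemigroupProperties

module _ (𝔽 : FiniteField) where
  open FiniteField 𝔽
  open Geometry 𝔽
  open IsCommutativeRing isCommutativeRing
    using (+-assoc; +-identityˡ; +-identityʳ; -‿inverseˡ; zeroˡ; zeroʳ;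
           *-identityˡ; *-assoc; *-comm; distribˡ; distribʳ)
  open Inverse enum using (to; from; strictlyInverseˡ)

  private
    F-ring : CommutativeRing 0ℓ 0ℓ
    F-ring = record { isCommutativeRing = isCommutativeRing }
    open RingProperties (CommutativeRing.ring F-ring) using (-1*x≈-x)
    open AbelianGroupProperties (CommutativeRing.+-abelianGroup F-ring)
      using (⁻¹-anti-homo‿-; inverseˡ-unique)
    open CommutativeSemigroupProperties
      (CommutativeRing.+-commutativeSemigroup F-ring) using (interchange)

  -- subtraction in F, in the form produced by the coordinates of _⊖_
  infixl 6 _−_
  _−_ : F → F → F
  a − b = a +F (-F b)

  -1F : F
  -1F = -F 1F

  neg-as-scaling : ∀ a → -F a ≡ -1F *F a
  neg-as-scaling a = sym (-1*x≈-x a)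

  −-split : ∀ a b c → (a − b) +F (b − c) ≡ a − c
  −-split a b c = begin
    (a − b) +F (b − c)         ≡⟨ +-assoc a (-F b) (b − c) ⟩
    a +F (-F b +F (b − c))     ≡⟨ cong (a +F_) (sym (+-assoc (-F b) b (-F c))) ⟩
    a +F ((-F b +F b) − c)     ≡⟨ cong (λ t → a +F (t − c)) (-‿inverseˡ b) ⟩
    a +F (0F − c)              ≡⟨ cong (a +F_) (+-identityˡ (-F c)) ⟩
    a − c                      ∎
    where open ≡-Reasoning

  −-cancel : ∀ a b → (a − b) +F b ≡ a
  −-cancel a b = begin
    (a − b) +F b      ≡⟨ +-assoc a (-F b) b ⟩
    a +F (-F b +F b)  ≡⟨ cong (a +F_) (-‿inverseˡ b) ⟩
    a +F 0F           ≡⟨ +-identityʳ a ⟩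
    a                 ∎
    where open ≡-Reasoning

  −-common : ∀ a b c → (a − c) − (b − c) ≡ a − b
  −-common a b c = trans (cong ((a − c) +F_) (⁻¹-anti-homo‿- b c)) (−-split a c b)

  _≟F_ : (a b : F) → Dec (a ≡ b)
  _≟F_ = via-injection (↔⇒↣ (↔-sym enum)) _≟Fin_

  -- A field has at least the two elements 0 ≠ 1, hence q ≥ 2.
  1<q : 1 < q
  1<q = injective⇒≤ {f = from ∘ zero-one} injective
    where
    zero-one : Fin 2 → F
    zero-one = 0F ◂ (1F ◂ λ ())
    from-injective : ∀ {a b} → from a ≡ from b → a ≡ b
    from-injective {a} {b} e =
      trans (sym (strictlyInverseˡ a)) (trans (cong to e) (strictlyInverseˡ b))
    injective : ∀ {i j} → from (zero-one i) ≡ from (zero-one j) → i ≡ j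
    injective {zero}     {zero}     _ = refl
    injective {zero}     {suc zero} e = ⊥-elim (0≢1 (from-injective e))
    injective {suc zero} {zero}     e = ⊥-elim (0≢1 (sym (from-injective e)))
    injective {suc zero} {suc zero} _ = refl

  ⊕-identityˡ : ∀ {m} (v : Pt m) → 𝟎 ⊕ v ≡ v
  ⊕-identityˡ = zipWith-identityˡ +-identityˡ

  ⊕-identityʳ : ∀ {m} (v : Pt m) → v ⊕ 𝟎 ≡ v
  ⊕-identityʳ = zipWith-identityʳ +-identityʳ

  ⊕-interchange : ∀ {m} (a b c d : Pt m) → (a ⊕ b) ⊕ (c ⊕ d) ≡ (a ⊕ c) ⊕ (b ⊕ d)
  ⊕-interchange []       []       []       []       = refl
  ⊕-interchange (a ∷ as) (b ∷ bs) (c ∷ cs) (d ∷ ds) =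
    cong₂ _∷_ (interchange a b c d) (⊕-interchange as bs cs ds)

  ·-zeroˡ : ∀ {m} (v : Pt m) → 0F · v ≡ 𝟎
  ·-zeroˡ []      = refl
  ·-zeroˡ (a ∷ v) = cong₂ _∷_ (zeroˡ a) (·-zeroˡ v)

  ·-zeroʳ : ∀ {m} a → a · 𝟎 {m} ≡ 𝟎
  ·-zeroʳ {ℕ.zero}  a = refl
  ·-zeroʳ {suc m}   a = cong₂ _∷_ (zeroʳ a) (·-zeroʳ a)

  ·-identityˡ : ∀ {m} (v : Pt m) → 1F · v ≡ v
  ·-identityˡ []      = refl
  ·-identityˡ (a ∷ v) = cong₂ _∷_ (*-identityˡ a) (·-identityˡ v)

  ·-assoc : ∀ {m} a b (v : Pt m) → (a *F b) · v ≡ a · (b · v)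
  ·-assoc a b []      = refl
  ·-assoc a b (x ∷ v) = cong₂ _∷_ (*-assoc a b x) (·-assoc a b v)

  ·-distribˡ : ∀ {m} a (u v : Pt m) → a · (u ⊕ v) ≡ (a · u) ⊕ (a · v)
  ·-distribˡ a []      []      = refl
  ·-distribˡ a (x ∷ u) (y ∷ v) = cong₂ _∷_ (distribˡ a x y) (·-distribˡ a u v)

  ·-distribʳ : ∀ {m} a b (v : Pt m) → (a +F b) · v ≡ (a · v) ⊕ (b · v)
  ·-distribʳ a b []      = refl
  ·-distribʳ a b (x ∷ v) = cong₂ _∷_ (distribʳ x a b) (·-distribʳ a b v)

  ⊖-as-⊕ : ∀ {m} (u v : Pt m) → u ⊖ v ≡ u ⊕ (-1F · v)
  ⊖-as-⊕ []      []      = refl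
  ⊖-as-⊕ (a ∷ u) (b ∷ v) = cong₂ _∷_ (cong (a +F_) (neg-as-scaling b)) (⊖-as-⊕ u v)

  ⊖-split : ∀ {m} (u z p : Pt m) → (u ⊖ z) ⊕ (z ⊖ p) ≡ u ⊖ p
  ⊖-split []      []      []      = refl
  ⊖-split (a ∷ u) (b ∷ z) (c ∷ p) = cong₂ _∷_ (−-split a b c) (⊖-split u z p)

  ⊖-common : ∀ {m} (u z p : Pt m) → (u ⊖ p) ⊖ (z ⊖ p) ≡ u ⊖ z
  ⊖-common []      []      []      = refl
  ⊖-common (a ∷ u) (b ∷ z) (c ∷ p) = cong₂ _∷_ (−-common a b c) (⊖-common u z p)

  ⊖-cancel : ∀ {m} (x p : Pt m) → (x ⊖ p) ⊕ p ≡ x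
  ⊖-cancel []      []      = refl
  ⊖-cancel (a ∷ x) (b ∷ p) = cong₂ _∷_ (−-cancel a b) (⊖-cancel x p)

  ⊖-injective : ∀ {m} (x y p : Pt m) → x ⊖ p ≡ y ⊖ p → x ≡ y
  ⊖-injective x y p e =
    trans (sym (⊖-cancel x p)) (trans (cong (_⊕ p) e) (⊖-cancel y p))

  ⊕-inverse-unique : ∀ {m} (u v : Pt m) → u ⊕ v ≡ 𝟎 → u ≡ -1F · v
  ⊕-inverse-unique []      []      _ = refl
  ⊕-inverse-unique (a ∷ u) (b ∷ v) e =
    cong₂ _∷_ (trans (inverseˡ-unique a b (proj₁ (∷-injective e))) (neg-as-scaling b))
              (⊕-inverse-unique u v (proj₂ (∷-injective e)))

  lincomb-cong : ∀ {m} k (c d : Fin k → F) (v : Fin k → Pt m) →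
                 (∀ i → c i ≡ d i) → lincomb k c v ≡ lincomb k d v
  lincomb-cong ℕ.zero  c d v e = refl
  lincomb-cong (suc k) c d v e =
    cong₂ _⊕_ (cong (_· v zero) (e zero))
              (lincomb-cong k (c ∘ suc) (d ∘ suc) (v ∘ suc) (e ∘ suc))

  lincomb-zero : ∀ {m} k (v : Fin k → Pt m) → lincomb k (λ _ → 0F) v ≡ 𝟎
  lincomb-zero ℕ.zero  v = refl
  lincomb-zero (suc k) v =
    trans (cong₂ _⊕_ (·-zeroˡ (v zero)) (lincomb-zero k (v ∘ suc))) (⊕-identityˡ 𝟎)

  lincomb-+ : ∀ {m} k (c d : Fin k → F) (v : Fin k → Pt m) →
              lincomb k (λ i → c i +F d i) v ≡ lincomb k c v ⊕ lincomb k d v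
  lincomb-+ ℕ.zero  c d v = sym (⊕-identityˡ 𝟎)
  lincomb-+ (suc k) c d v =
    trans (cong₂ _⊕_ (·-distribʳ (c zero) (d zero) (v zero))
                     (lincomb-+ k (c ∘ suc) (d ∘ suc) (v ∘ suc)))
          (⊕-interchange _ _ _ _)

  lincomb-* : ∀ {m} k a (c : Fin k → F) (v : Fin k → Pt m) →
              lincomb k (λ i → a *F c i) v ≡ a · lincomb k c v
  lincomb-* ℕ.zero  a c v = sym (·-zeroʳ a)
  lincomb-* (suc k) a c v =
    trans (cong₂ _⊕_ (·-assoc a (c zero) (v zero)) (lincomb-* k a (c ∘ suc) (v ∘ suc)))
          (sym (·-distribˡ a _ _))

  span-𝟎 : ∀ {m k} (v : Fin k → Pt m) → Span v 𝟎
  span-𝟎 {k = k} v = (λ _ → 0F) , lincomb-zero k v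

  span-⊕ : ∀ {m k} (v : Fin k → Pt m) {x y} → Span v x → Span v y → Span v (x ⊕ y)
  span-⊕ {k = k} v (c , refl) (d , refl) = (λ i → c i +F d i) , lincomb-+ k c d v

  span-· : ∀ {m k} (v : Fin k → Pt m) a {x} → Span v x → Span v (a · x)
  span-· {k = k} v a (c , refl) = (λ i → a *F c i) , lincomb-* k a c v

  span-⊖ : ∀ {m k} (v : Fin k → Pt m) {x y} → Span v x → Span v y → Span v (x ⊖ y)
  span-⊖ v {x} {y} sx sy = subst (Span v) (sym (⊖-as-⊕ x y)) (span-⊕ v sx (span-· v -1F sy))

  span-mono : ∀ {m k l} (v : Fin k → Pt m) (w : Fin l → Pt m) →
              (∀ i → Span w (v i)) → ∀ x → Span v x → Span w x
  span-mono {k = ℕ.zero}  v w v⊆w x (c , refl) = span-𝟎 w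
  span-mono {k = suc k}   v w v⊆w x (c , refl) =
    span-⊕ w (span-· w (c zero) (v⊆w zero))
             (span-mono (v ∘ suc) w (v⊆w ∘ suc) _ (c ∘ suc , refl))

  span-◂ : ∀ {m k} (w : Pt m) (v : Fin k → Pt m) → ∀ x → Span v x → Span (w ◂ v) x
  span-◂ {k = k} w v x (c , refl) =
    (0F ◂ c) , trans (cong (_⊕ lincomb k c v) (·-zeroˡ w)) (⊕-identityˡ _)

  span-head : ∀ {m k} (w : Pt m) (v : Fin k → Pt m) → Span (w ◂ v) w
  span-head {k = k} w v =
    (1F ◂ λ _ → 0F) , trans (cong₂ _⊕_ (·-identityˡ w) (lincomb-zero k v)) (⊕-identityʳ w)

  solve-for : ∀ {m k} (X : Fin k → Pt m) a w L →
              a ≢ 0F → (a · w) ⊕ L ≡ 𝟎 → Span X L → Span X w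
  solve-for X a w L a≢0 e L∈X with inverse a a≢0
  ... | a⁻¹ , aa⁻¹≡1 =
    subst (Span X) (sym w≡) (span-· X -1F (span-· X a⁻¹ L∈X))
    where
    open ≡-Reasoning
    a⁻¹a·w : a⁻¹ · (a · w) ≡ w
    a⁻¹a·w = begin
      a⁻¹ · (a · w)    ≡⟨ sym (·-assoc a⁻¹ a w) ⟩
      (a⁻¹ *F a) · w   ≡⟨ cong (_· w) (trans (*-comm a⁻¹ a) aa⁻¹≡1) ⟩
      1F · w           ≡⟨ ·-identityˡ w ⟩
      w                ∎
    w⊕a⁻¹L : w ⊕ (a⁻¹ · L) ≡ 𝟎
    w⊕a⁻¹L = begin
      w ⊕ (a⁻¹ · L)              ≡⟨ cong (_⊕ (a⁻¹ · L)) (sym a⁻¹a·w) ⟩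
      (a⁻¹ · (a · w)) ⊕ (a⁻¹ · L) ≡⟨ sym (·-distribˡ a⁻¹ (a · w) L) ⟩
      a⁻¹ · ((a · w) ⊕ L)         ≡⟨ cong (a⁻¹ ·_) e ⟩
      a⁻¹ · 𝟎                     ≡⟨ ·-zeroʳ a⁻¹ ⟩
      𝟎                           ∎
    w≡ : w ≡ -1F · (a⁻¹ · L)
    w≡ = ⊕-inverse-unique w (a⁻¹ · L) w⊕a⁻¹L

  indep-◂ : ∀ {m k} (w : Pt m) (v : Fin k → Pt m) →
            LinIndep v → ¬ Span v w → LinIndep (w ◂ v)
  indep-◂ w v v-indep w∉ c e i with c zero ≟F 0F
  ... | no c₀≢0 = ⊥-elim (w∉ (solve-for v (c zero) w _ c₀≢0 e (c ∘ suc , refl)))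
  ... | yes c₀≡0 with i
  ...   | zero  = c₀≡0
  ...   | suc j = v-indep (c ∘ suc) tail≡𝟎 j
    where
    tail≡𝟎 : lincomb _ (c ∘ suc) v ≡ 𝟎
    tail≡𝟎 = trans (sym (⊕-identityˡ _))
               (trans (cong (_⊕ _) (sym (trans (cong (_· w) c₀≡0) (·-zeroˡ w)))) e)

  -- Finiteness: coefficient vectors in F^k are numbered by Fin (q ^ k)

  encode : ∀ {k} → (Fin k → F) → Fin (q ^ k)
  encode c = funToFin (from ∘ c)

  decode : ∀ {k} → Fin (q ^ k) → (Fin k → F)
  decode j = to ∘ finToFun j

  decode-encode : ∀ {k} (c : Fin k → F) i → decode (encode c) i ≡ c i
  decode-encode c i = trans (cong to (finToFun-funToFin (from ∘ c) i)) (strictlyInverseˡ (c i))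

  _≟V_ : ∀ {m} (y z : Pt m) → Dec (y ≡ z)
  _≟V_ = ≡-dec _≟F_

  -- Membership in a span is decidable: search all q^k coefficient vectors.
  span? : ∀ {m k} (v : Fin k → Pt m) x → Dec (Span v x)
  span? {k = k} v x with any? (λ j → lincomb k (decode j) v ≟V x)
  ... | yes (j , e) = yes (decode j , e)
  ... | no none     = no λ { (c , e) →
          none (encode c , trans (lincomb-cong k _ c v (decode-encode c)) e) }

  -- An affine space p + ⟨v₁,…,v_k⟩ has at most q^k points: a set of N points
  -- inside it satisfies N ≤ q^k (distinct points have distinct coordinates).
  affine-count : ∀ {m N k} (U : PointSet m N) (p : Pt m) (v : Fin k → Pt m) →
                 (∀ i → Span v (PointSet.elem U i ⊖ p)) → N ≤ q ^ k
  affine-count {k = k} U p v inside = injective⇒≤ {f = encode ∘ coords} coords-injective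
    where
    open PointSet U
    coords : _ → Fin k → F
    coords i = proj₁ (inside i)
    coords-injective : ∀ {i j} → encode (coords i) ≡ encode (coords j) → i ≡ j
    coords-injective {i} {j} e = elem-inj (⊖-injective _ _ p (begin
      elem i ⊖ p                  ≡⟨ sym (proj₂ (inside i)) ⟩
      lincomb k (coords i) v      ≡⟨ lincomb-cong k _ _ v same-coords ⟩
      lincomb k (coords j) v      ≡⟨ proj₂ (inside j) ⟩
      elem j ⊖ p                  ∎))
      where
      open ≡-Reasoning
      same-coords : ∀ l → coords i l ≡ coords j l
      same-coords l = trans (sym (decode-encode (coords i) l))
                        (trans (cong (λ t → decode t l) e) (decode-encode (coords j) l))

  adjoin : ∀ {n k} (S : SubspaceAtInfinity n k) (w : Pt n) →
           ¬ ⟦ S ⟧ w → SubspaceAtInfinity n (suc k)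
  adjoin (subspace b b-indep) w w∉ = subspace (w ◂ b) (indep-◂ w b b-indep w∉)

  adjoin-⊇ : ∀ {n k} (S : SubspaceAtInfinity n k) w (w∉ : ¬ ⟦ S ⟧ w) → S ⊆∞ adjoin S w w∉
  adjoin-⊇ (subspace b _) w _ = span-◂ w b

  -- If S is determined by U through the affine space p + S, and u ∈ U lies
  -- outside p + S, then ⟨S, u − p⟩ is determined by U: the witnesses
  -- x₀,…,x_{k+1} together with u are affinely independent points of U in
  -- p + ⟨S, u − p⟩.
  determined-adjoin : ∀ {n N k} (U : PointSet n N) (S : SubspaceAtInfinity n k) →
    (D : Determined U S) → ∀ u → u ∈U U → (u∉ : ¬ ⟦ S ⟧ (u ⊖ proj₁ D)) →
    Determined U (adjoin S (u ⊖ proj₁ D) u∉)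
  determined-adjoin U (subspace b _) (p , x , x∈U , x∈T , x-indep) u u∈U u∉ =
    p , x zero ◂ (u ◂ tailᶠ x) , points∈U , points∈T ,
    indep-◂ (u ⊖ x zero) dir x-indep new-direction
    where
    dir : Fin _ → Pt _
    dir i = x (suc i) ⊖ x zero
    dir⊆S : ∀ i → Span b (dir i)
    dir⊆S i = subst (Span b) (⊖-common (x (suc i)) (x zero) p)
                (span-⊖ b (x∈T (suc i)) (x∈T zero))
    new-direction : ¬ Span dir (u ⊖ x zero)
    new-direction u∈dir = u∉ (subst (Span b) (⊖-split u (x zero) p)
      (span-⊕ b (span-mono dir b dir⊆S _ u∈dir) (x∈T zero)))
    points∈U : ∀ i → (x zero ◂ (u ◂ tailᶠ x)) i ∈U U
    points∈U zero          = x∈U zero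
    points∈U (suc zero)    = u∈U
    points∈U (suc (suc i)) = x∈U (suc i)
    points∈T : ∀ i → Span (u ⊖ p ◂ b) ((x zero ◂ (u ◂ tailᶠ x)) i ⊖ p)
    points∈T zero          = span-◂ (u ⊖ p) b _ (x∈T zero)
    points∈T (suc zero)    = span-head (u ⊖ p) b
    points∈T (suc (suc i)) = span-◂ (u ⊖ p) b _ (x∈T (suc i))

  -- One step: if q^(k+1) < |U|, the affine (k+1)-space p + S cannot contain
  -- all of U, so a determined S_k lies in a determined S_{k+1}.
  grow : ∀ {n N k} (U : PointSet n N) → q ^ suc k < N →
    (S : SubspaceAtInfinity n k) → Determined U S →
    Σ (SubspaceAtInfinity n (suc k)) λ S' → S ⊆∞ S' × Determined U S'
  grow U big S@(subspace b _) D@(p , _)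
    with any? (λ i → ¬? (span? b (PointSet.elem U i ⊖ p)))
  ... | yes (i , out) =
    adjoin S _ out , adjoin-⊇ S _ out , determined-adjoin U S D _ (i , refl) out
  ... | no none = ⊥-elim (<⇒≱ big (affine-count U p b all-inside))
    where
    all-inside : ∀ i → Span b (PointSet.elem U i ⊖ p)
    all-inside i = decidable-stable (span? b _) (λ out → none (i , out))

  grow-to : ∀ {n N k T} (U : PointSet n N) → k ≤′ T → q ^ T < N →
    (S : SubspaceAtInfinity n k) → Determined U S →
    Σ (SubspaceAtInfinity n T) λ S' → S ⊆∞ S' × Determined U S'
  grow-to U ≤′-refl _ S D = S , (λ _ x∈S → x∈S) , D
  grow-to {T = suc T} U (≤′-step k≤T) big S D
    with grow-to U k≤T (<-trans (^-monoʳ-< q 1<q (n<1+n T)) big) S D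
  ... | S₁ , S⊆S₁ , D₁ with grow U big S₁ D₁
  ...   | S₂ , S₁⊆S₂ , D₂ = S₂ , (λ x → S₁⊆S₂ x ∘ S⊆S₁ x) , D₂

-- Since |U| = q^(n-1) > q^(n-2) and k ≤ n − 2, grow S_k up to dimension n − 2.
corollary1 : (𝔽 : FiniteField) (n k : ℕ) → k + 2 ≤ n →
    (U : Geometry.PointSet 𝔽 n (FiniteField.q 𝔽 ^ (n ∸ 1))) →
    (S : Geometry.SubspaceAtInfinity 𝔽 n k) →
    Geometry.Determined 𝔽 U S →
    Σ (Geometry.SubspaceAtInfinity 𝔽 n (n ∸ 2)) λ S' →
    Geometry._⊆∞_ 𝔽 S S' × Geometry.Determined 𝔽 U S'
corollary1 𝔽 (suc (suc n)) k k+2≤n U S D =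
  grow-to 𝔽 U (≤⇒≤′ (m+n≤o⇒m≤o∸n k k+2≤n)) (^-monoʳ-< q (1<q 𝔽) (n<1+n n)) S D
  where open FiniteField 𝔽 using (q)
-- n ≥ 2 is forced by k + 2 ≤ n
corollary1 𝔽 ℕ.zero k k+2≤n U S D with m+n≤o⇒n≤o k k+2≤n
... | ()
corollary1 𝔽 (suc ℕ.zero) k k+2≤n U S D with m+n≤o⇒n≤o k k+2≤n
... | s≤s ()
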